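{- Let $v\in\mathcal L(\mathbf p)\setminus\{\varepsilon\}$ be a bispecial factor of $\mathbf p$. (1) If $0v,2v,v0,v2\in\mathcal L(\mathbf p)$, there exists $w$ such that $v=1\varphi(w)$ and $0w,1w,w1,w2\in\mathcal L(\mathbf p)$. (2) If $0v,1v,v1,v2\in\mathcal L(\mathbf p)$, there exists $w$ such that $v=\varphi(w)0$ and $0w,2w,w0,w2\in\mathcal L(\mathbf p)$. (3) If $0v,2v,v1,v2\in\mathcal L(\mathbf p)$, there exists $w$ such that $v=1\varphi(w)0$ and $0w,1w,w0,w2\in\mathcal L(\mathbf p)$. (4) If $0v,1v,v0,v2\in\mathcal L(\mathbf p)$, there exists $w$ such that $v=\varphi(w)$ and $0w,2w,w1,w2\in\mathcal L(\mathbf p)$.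
   Context: $\varphi$ is the morphism on $\{0,1,2\}^*$ given by $\varphi(0)=01$, $\varphi(1)=21$, $\varphi(2)=0$, and $\mathbf p$ is its infinite fixed point starting with $0$. $\mathcal L(\mathbf u)$ is the set of finite factors of $\mathbf u$. A factor $w$ is left special (resp. right special) if $aw,bw\in\mathcal L(\mathbf u)$ (resp. $wa,wb\in\mathcal L(\mathbf u)$) for two distinct letters $a,b$; it is bispecial if it is both. -}

module Defs where

open import Data.Nat using (ℕ; zero; suc; _+_)
open import Data.Fin using (Fin; zero; suc; toℕ)
open import Data.List using (List; []; _∷_; _++_; concatMap; length; lookup)
open import Data.Product using (∃-syntax; _×_)
open import Relation.Binary.PropositionalEquality using (_≡_)

Letter : Set
Letter = Fin 3

Word : Set
Word = List Letter

l0 l1 l2 : Letter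
l0 = zero
l1 = suc zero
l2 = suc (suc zero)

φₗ : Letter → Word
φₗ zero = l0 ∷ l1 ∷ []
φₗ (suc zero) = l2 ∷ l1 ∷ []
φₗ (suc (suc zero)) = l0 ∷ []

φ : Word → Word
φ = concatMap φₗ

φ^ : ℕ → Word → Word
φ^ zero w = w
φ^ (suc k) w = φ (φ^ k w)

-- n-th letter of a word, with a default value l0 when out of range
at : Word → ℕ → Letter
at [] n = l0
at (a ∷ w) zero = a
at (a ∷ w) (suc n) = at w n

-- The fixed point p = lim φ^k(0); its n-th letter (0-indexed) is the n-th
-- letter of φ^(n+1)(0), which has length ≥ n+2 and is a prefix of p.
p : ℕ → Letter
p n = at (φ^ (suc n) (l0 ∷ [])) n

Factor : Word → Set
Factor w = ∃[ i ] (∀ (j : Fin (length w)) → p (i + toℕ j) ≡ lookup w j)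

{-# OPTIONS --safe #-}
-- Since φ(0) = 01, φ(1) = 21 and φ(2) = 0, the letters 0 and 2 are exactly the first letters of
-- φ-blocks. The blocks of φ² are 0121, 021 and 01, so the two-letter factors of p are 01, 02, 10,
-- 12 and 21; in particular a 1 is always followed by a block head. Hence an occurrence of a factor
-- that begins and ends at block boundaries desubstitutes: the factor is φ(t) for a unique t, which
-- is itself a factor, and the letters around the occurrence come from letters around t. For a
-- bispecial v, the letters before and after v locate the block boundaries, which gives the shape
-- of v around φ(w), and each extension of v yields an extension of w. The one extension of w not
-- obtained directly is forced, because for nonempty w the factors 1w and 2w (and w0 and w1) never
-- both occur.
module Submission where

open import Defs
open import Data.Empty using (⊥-elim)
open import Data.Fin using (Fin; zero; suc; toℕ)
open import Data.List using (List; []; _∷_; _++_; length; lookup; head; concat; map; InitLast; initLast; _∷ʳ′_)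
open import Data.List.Properties
  using (++-assoc; ++-identityʳ; ∷-injective; map-++; concat-++; length-++-sucʳ; length-++-≤ˡ)
import Data.List.Relation.Unary.Linked as Linked
open Linked using (Linked; []; [-]; _∷_)
open import Data.List.Relation.Unary.Linked.Properties using (++⁺)
open import Data.Maybe using (just)
open import Data.Maybe.Relation.Binary.Connected using (Connected; just; just-nothing)
open import Data.Nat using (ℕ; zero; suc; _+_; _≤_; _<_; _≤′_; ≤′-refl; ≤′-step; z≤n; s≤s)
open import Data.Nat.Properties
  using (≤-total; ≤⇒≤′; <⇒≤; ≤-trans; <-≤-trans; <-trans; n<1+n; m≤n+m; +-suc; +-identityʳ)
open import Data.Product using (∃-syntax; _×_; _,_)
open import Data.Sum as Sum using (_⊎_; inj₁; inj₂)
open import Data.Unit using (⊤; tt)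
open import Relation.Binary.PropositionalEquality
  using (_≡_; refl; sym; trans; cong; cong₂; subst; module ≡-Reasoning)
open import Relation.Nullary using (¬_; contradiction)

-- The morphism φ

φ-++ : ∀ x y → φ (x ++ y) ≡ φ x ++ φ y
φ-++ x y = trans (cong concat (map-++ φₗ x y)) (sym (concat-++ (map φₗ x) (map φₗ y)))

φ-∷-nonempty : ∀ x r → ∃[ y ] ∃[ ys ] (φ (x ∷ r) ≡ y ∷ ys)
φ-∷-nonempty zero             _ = _ , _ , refl
φ-∷-nonempty (suc zero)       _ = _ , _ , refl
φ-∷-nonempty (suc (suc zero)) _ = _ , _ , refl

data BlockHead : Letter → Set where
  head-0 : BlockHead l0
  head-2 : BlockHead l2

AtBoundary : Word → Set
AtBoundary []      = ⊤
AtBoundary (c ∷ _) = BlockHead c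

φ-atBoundary : ∀ t → AtBoundary (φ t)
φ-atBoundary []                   = tt
φ-atBoundary (zero ∷ _)           = head-0
φ-atBoundary (suc zero ∷ _)       = head-2
φ-atBoundary (suc (suc zero) ∷ _) = head-0

atBoundary-++⁺ : ∀ u {c z} → AtBoundary u → BlockHead c → AtBoundary (u ++ c ∷ z)
atBoundary-++⁺ []      _  hc = hc
atBoundary-++⁺ (_ ∷ _) hu _  = hu

φₗ-++-injective : ∀ a b {r s} → φₗ a ++ r ≡ φₗ b ++ s → AtBoundary r → AtBoundary s →
  a ≡ b × r ≡ s
φₗ-++-injective zero             zero             refl _  _  = refl , refl
φₗ-++-injective zero             (suc zero)       ()   _  _
φₗ-++-injective zero             (suc (suc zero)) refl _  ()
φₗ-++-injective (suc zero)       zero             ()   _  _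
φₗ-++-injective (suc zero)       (suc zero)       refl _  _  = refl , refl
φₗ-++-injective (suc zero)       (suc (suc zero)) ()   _  _
φₗ-++-injective (suc (suc zero)) zero             refl () _
φₗ-++-injective (suc (suc zero)) (suc zero)       ()   _  _
φₗ-++-injective (suc (suc zero)) (suc (suc zero)) refl _  _  = refl , refl

φ-injective : ∀ x y → φ x ≡ φ y → x ≡ y
φ-injective []      []      _ = refl
φ-injective []      (b ∷ y) e with _ , _ , e′ ← φ-∷-nonempty b y with () ← trans e e′
φ-injective (a ∷ x) []      e with _ , _ , e′ ← φ-∷-nonempty a x with () ← trans (sym e) e′
φ-injective (a ∷ x) (b ∷ y) e with refl , e′ ← φₗ-++-injective a b e (φ-atBoundary x) (φ-atBoundary y) =
  cong (a ∷_) (φ-injective x y e′)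

φₗ-++-split : ∀ y x a {r c} → φₗ y ++ r ≡ x ∷ a ++ c → AtBoundary c →
  ∃[ a′ ] (x ∷ a ≡ φₗ y ++ a′ × r ≡ a′ ++ c)
φₗ-++-split zero             _ []      refl ()
φₗ-++-split zero             _ (_ ∷ a) e    _
  with refl , e′ ← ∷-injective e with refl , e″ ← ∷-injective e′ = a , refl , e″
φₗ-++-split (suc zero)       _ []      refl ()
φₗ-++-split (suc zero)       _ (_ ∷ a) e    _
  with refl , e′ ← ∷-injective e with refl , e″ ← ∷-injective e′ = a , refl , e″
φₗ-++-split (suc (suc zero)) _ a       e    _ with refl , e′ ← ∷-injective e = a , refl , e′

φ-split : ∀ Y a {c} → φ Y ≡ a ++ c → AtBoundary c →
  ∃[ y₁ ] ∃[ y₂ ] (Y ≡ y₁ ++ y₂ × φ y₁ ≡ a × φ y₂ ≡ c)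
φ-split Y       []      e  _  = [] , Y , refl , refl , e
φ-split []      (_ ∷ _) () _
φ-split (y ∷ Y) (x ∷ a) e  hc with a′ , e₁ , e₂ ← φₗ-++-split y x a e hc
  with y₁ , y₂ , refl , refl , e₃ ← φ-split Y a′ e₂ hc = y ∷ y₁ , y₂ , refl , sym e₁ , e₃

-- Occurrences in p

p-prefix : ℕ → Word
p-prefix k = φ^ k (l0 ∷ [])

p-prefix-step : ∀ k → ∃[ x ] ∃[ r ] (p-prefix (suc k) ≡ p-prefix k ++ x ∷ r)
p-prefix-step zero = l1 , [] , refl
p-prefix-step (suc k) with x , r , e ← p-prefix-step k with y , ys , e′ ← φ-∷-nonempty x r =
  y , ys , (begin
  φ (p-prefix (suc k))             ≡⟨ cong φ e ⟩
  φ (p-prefix k ++ x ∷ r)          ≡⟨ φ-++ (p-prefix k) (x ∷ r) ⟩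
  p-prefix (suc k) ++ φ (x ∷ r)    ≡⟨ cong (p-prefix (suc k) ++_) e′ ⟩
  p-prefix (suc k) ++ y ∷ ys       ∎)
  where open ≡-Reasoning

p-prefix-mono : ∀ {k m} → k ≤′ m → ∃[ r ] (p-prefix m ≡ p-prefix k ++ r)
p-prefix-mono ≤′-refl = [] , sym (++-identityʳ _)
p-prefix-mono {k} (≤′-step {m} k≤m) with r , e ← p-prefix-mono k≤m with x , r′ , e′ ← p-prefix-step m =
  r ++ x ∷ r′ , (begin
  p-prefix (suc m)             ≡⟨ e′ ⟩
  p-prefix m ++ x ∷ r′         ≡⟨ cong (_++ x ∷ r′) e ⟩
  (p-prefix k ++ r) ++ x ∷ r′  ≡⟨ ++-assoc (p-prefix k) r (x ∷ r′) ⟩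
  p-prefix k ++ r ++ x ∷ r′    ∎)
  where open ≡-Reasoning

length-p-prefix : ∀ k → k < length (p-prefix k)
length-p-prefix zero = s≤s z≤n
length-p-prefix (suc k) with x , r , e ← p-prefix-step k =
  subst (suc k <_) (trans (sym (length-++-sucʳ (p-prefix k) x r)) (cong length (sym e)))
    (s≤s (<-≤-trans (length-p-prefix k) (length-++-≤ˡ (p-prefix k))))

at-++ˡ : ∀ x y {n} → n < length x → at (x ++ y) n ≡ at x n
at-++ˡ (_ ∷ _) _ {zero}  _        = refl
at-++ˡ (_ ∷ x) y {suc n} (s≤s lt) = at-++ˡ x y lt

at-p-prefix : ∀ k n → n < length (p-prefix k) → at (p-prefix k) n ≡ p n
at-p-prefix k n lt with ≤-total k (suc n)
... | inj₁ k≤ with r , e ← p-prefix-mono (≤⇒≤′ k≤) =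
  sym (trans (cong (λ w → at w n) e) (at-++ˡ (p-prefix k) r lt))
... | inj₂ ≤k with r , e ← p-prefix-mono (≤⇒≤′ ≤k) =
  trans (cong (λ w → at w n) e) (at-++ˡ (p-prefix (suc n)) r (<-trans (n<1+n n) (length-p-prefix (suc n))))

OccursAt : ℕ → Word → Set
OccursAt i []      = ⊤
OccursAt i (x ∷ u) = p i ≡ x × OccursAt (suc i) u

lookup⇒occursAt : ∀ {i} u → (∀ (j : Fin (length u)) → p (i + toℕ j) ≡ lookup u j) → OccursAt i u
lookup⇒occursAt     []      _ = tt
lookup⇒occursAt {i} (_ ∷ u) f =
  trans (cong p (sym (+-identityʳ i))) (f zero) ,
  lookup⇒occursAt u (λ j → trans (cong p (sym (+-suc i (toℕ j)))) (f (suc j)))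

occursAt⇒lookup : ∀ {i} u → OccursAt i u → ∀ (j : Fin (length u)) → p (i + toℕ j) ≡ lookup u j
occursAt⇒lookup {i} (_ ∷ _) (e , _) zero    = trans (cong p (+-identityʳ i)) e
occursAt⇒lookup {i} (_ ∷ u) (_ , o) (suc j) = trans (cong p (+-suc i (toℕ j))) (occursAt⇒lookup u o j)

Factor⇒occursAt : ∀ {u} → Factor u → ∃[ i ] OccursAt i u
Factor⇒occursAt (i , f) = i , lookup⇒occursAt _ f

occursAt⇒Factor : ∀ {i u} → OccursAt i u → Factor u
occursAt⇒Factor {i} o = i , occursAt⇒lookup _ o

occursAt-++⁻ˡ : ∀ {i} u {v} → OccursAt i (u ++ v) → OccursAt i u
occursAt-++⁻ˡ []      _       = tt
occursAt-++⁻ˡ (_ ∷ u) (e , o) = e , occursAt-++⁻ˡ u o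

occursAt-++⁻ʳ : ∀ {i} u {v} → OccursAt i (u ++ v) → OccursAt (length u + i) v
occursAt-++⁻ʳ     []      o       = o
occursAt-++⁻ʳ {i} (_ ∷ u) {v} (_ , o) =
  subst (λ k → OccursAt k v) (+-suc (length u) i) (occursAt-++⁻ʳ u o)

occursAt-∷ʳ : ∀ {i} u → OccursAt i u → OccursAt i (u ++ p (length u + i) ∷ [])
occursAt-∷ʳ     []      _       = refl , tt
occursAt-∷ʳ {i} (_ ∷ u) (e , o) =
  e , subst (λ k → OccursAt (suc i) (u ++ p k ∷ [])) (+-suc (length u) i) (occursAt-∷ʳ u o)

occursAt-at : ∀ i x → (∀ n → n < length x → at x n ≡ p (i + n)) → OccursAt i x
occursAt-at i []      _ = tt
occursAt-at i (_ ∷ x) h =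
  trans (cong p (sym (+-identityʳ i))) (sym (h 0 (s≤s z≤n))) ,
  occursAt-at (suc i) x (λ n lt → trans (h (suc n) (s≤s lt)) (cong p (+-suc i n)))

p-prefix-occurs : ∀ k → OccursAt 0 (p-prefix k)
p-prefix-occurs k = occursAt-at 0 (p-prefix k) (at-p-prefix k)

occursAt-prefix : ∀ {i} u x → OccursAt i u → OccursAt i x → length u ≤ length x → ∃[ b ] (x ≡ u ++ b)
occursAt-prefix []      x       _           _           _        = x , refl
occursAt-prefix (_ ∷ u) (_ ∷ x) (refl , ou) (refl , ox) (s≤s le) with b , e ← occursAt-prefix u x ou ox le =
  b , cong (_ ∷_) e

occursAt-infix : ∀ d {j} u x → OccursAt (j + d) u → OccursAt j x → d + length u ≤ length x →
  ∃[ a ] ∃[ b ] (x ≡ a ++ u ++ b)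
occursAt-infix zero    {j} u x       ou ox       le
  with b , e ← occursAt-prefix u x (subst (λ k → OccursAt k u) (+-identityʳ j) ou) ox le = [] , b , e
occursAt-infix (suc d)     u []      _  _        ()
occursAt-infix (suc d) {j} u (y ∷ x) ou (_ , ox) (s≤s le)
  with a , b , e ← occursAt-infix d u x (subst (λ k → OccursAt k u) (+-suc j d) ou) ox le =
  y ∷ a , b , cong (y ∷_) e

-- The occurrence is placed inside a φ²-image so that it can be desubstituted and its bigrams read off.
Factor⇒infix-φ² : ∀ {u} → Factor u → ∃[ m ] ∃[ a ] ∃[ b ] (φ (φ (p-prefix m)) ≡ a ++ u ++ b)
Factor⇒infix-φ² {u} f with i , o ← Factor⇒occursAt f =
  let m = i + length u
  in m , occursAt-infix i u (p-prefix (2 + m)) o (p-prefix-occurs (2 + m))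
           (≤-trans (m≤n+m m 2) (<⇒≤ (length-p-prefix (2 + m))))

p-prefix-suffix⇒Factor : ∀ k a {u} → p-prefix k ≡ a ++ u → Factor u
p-prefix-suffix⇒Factor k a e = occursAt⇒Factor (occursAt-++⁻ʳ a (subst (OccursAt 0) e (p-prefix-occurs k)))

Factor-++⁻ˡ : ∀ u {v} → Factor (u ++ v) → Factor u
Factor-++⁻ˡ u f with _ , o ← Factor⇒occursAt f = occursAt⇒Factor (occursAt-++⁻ˡ u o)

Factor-++⁻ʳ : ∀ u {v} → Factor (u ++ v) → Factor v
Factor-++⁻ʳ u f with _ , o ← Factor⇒occursAt f = occursAt⇒Factor (occursAt-++⁻ʳ u o)

Factor-extendʳ : ∀ u → Factor u → ∃[ c ] Factor (u ++ c ∷ [])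
Factor-extendʳ u f with _ , o ← Factor⇒occursAt f = _ , occursAt⇒Factor (occursAt-∷ʳ u o)

Factor-extendˡ : ∀ {x u} → ¬ x ≡ l0 → Factor (x ∷ u) → ∃[ c ] Factor (c ∷ x ∷ u)
Factor-extendˡ x≢0 f with Factor⇒occursAt f
... | zero  , e , _ = ⊥-elim (x≢0 (sym e))
... | suc i , o     = p i , occursAt⇒Factor (refl , o)

-- Two-letter factors

data Bigram : Letter → Letter → Set where
  b01 : Bigram l0 l1
  b02 : Bigram l0 l2
  b10 : Bigram l1 l0
  b12 : Bigram l1 l2
  b21 : Bigram l2 l1

φ²-head : ∀ Z → Connected Bigram (just l1) (head (φ (φ Z)))
φ²-head []                   = just-nothing
φ²-head (zero ∷ _)           = just b10
φ²-head (suc zero ∷ _)       = just b10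
φ²-head (suc (suc zero) ∷ _) = just b10

φ²-∷ : ∀ z {w} → Connected Bigram (just l1) (head w) → Linked Bigram w → Linked Bigram (φ (φₗ z) ++ w)
φ²-∷ zero             = ++⁺ (b01 ∷ b12 ∷ b21 ∷ [-])
φ²-∷ (suc zero)       = ++⁺ (b02 ∷ b21 ∷ [-])
φ²-∷ (suc (suc zero)) = ++⁺ (b01 ∷ [-])

φ²-linked : ∀ Z → Linked Bigram (φ (φ Z))
φ²-linked []      = []
φ²-linked (z ∷ Z) = subst (Linked Bigram) (sym (φ-++ (φₗ z) (φ Z))) (φ²-∷ z (φ²-head Z) (φ²-linked Z))

Linked-++-∷-∷ : ∀ {a ℓ} {A : Set a} {R : A → A → Set ℓ} (x : List A) {c d z} →
  Linked R (x ++ c ∷ d ∷ z) → R c d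
Linked-++-∷-∷ []      l = Linked.head l
Linked-++-∷-∷ (_ ∷ x) l = Linked-++-∷-∷ x (Linked.tail l)

bigram : ∀ {c d u} → Factor (c ∷ d ∷ u) → Bigram c d
bigram f with m , a , _ , e ← Factor⇒infix-φ² f =
  Linked-++-∷-∷ a (subst (Linked Bigram) e (φ²-linked (p-prefix m)))

bigram-last : ∀ u {c d} → Factor ((u ++ c ∷ []) ++ d ∷ []) → Bigram c d
bigram-last u {c} {d} f = bigram (Factor-++⁻ʳ u (subst Factor (++-assoc u (c ∷ []) (d ∷ [])) f))

after-1 : ∀ {c} → Bigram l1 c → BlockHead c
after-1 b10 = head-0
after-1 b12 = head-2

after-2 : ∀ {c} → Bigram l2 c → c ≡ l1
after-2 b21 = refl

¬after-1-and-2 : ∀ {c} → Bigram l1 c → ¬ Bigram l2 c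
¬after-1-and-2 b10 ()
¬after-1-and-2 b12 ()

before-0 : ∀ {c} → Bigram c l0 → c ≡ l1
before-0 b10 = refl

before-1-and-2 : ∀ {c} → Bigram c l1 → Bigram c l2 → c ≡ l0
before-1-and-2 b01 b02 = refl
before-1-and-2 b21 ()

¬before-0-and-1 : ∀ {c} → Bigram c l0 → ¬ Bigram c l1
¬before-0-and-1 b10 ()

Factor-1∷⇒atBoundary : ∀ {v} → Factor (l1 ∷ v) → AtBoundary v
Factor-1∷⇒atBoundary {[]}    _ = tt
Factor-1∷⇒atBoundary {_ ∷ _} f = after-1 (bigram f)

Factor-extendˡ-1 : ∀ {u} → Factor (l1 ∷ u) → Factor (l0 ∷ l1 ∷ u) ⊎ Factor (l2 ∷ l1 ∷ u)
Factor-extendˡ-1 {u} f = let _ , g = Factor-extendˡ (λ ()) f in by-letter (bigram g) g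
  where
  by-letter : ∀ {c} → Bigram c l1 → Factor (c ∷ l1 ∷ u) →
    Factor (l0 ∷ l1 ∷ u) ⊎ Factor (l2 ∷ l1 ∷ u)
  by-letter b01 g = inj₁ g
  by-letter b21 g = inj₂ g

ends-in-1 : ∀ v → ¬ v ≡ [] → Factor (v ++ l0 ∷ []) → ∃[ u ] (v ≡ u ++ l1 ∷ [])
ends-in-1 v = go (initLast v)
  where
  go : ∀ {v} → InitLast v → ¬ v ≡ [] → Factor (v ++ l0 ∷ []) → ∃[ u ] (v ≡ u ++ l1 ∷ [])
  go []        v≢[] _ = ⊥-elim (v≢[] refl)
  go (u ∷ʳ′ _) _    f = u , cong (λ c → u ++ c ∷ []) (before-0 (bigram-last u f))

ends-in-0 : ∀ v → ¬ v ≡ [] → Factor (v ++ l1 ∷ []) → Factor (v ++ l2 ∷ []) →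
  ∃[ u ] (u ++ l0 ∷ [] ≡ v)
ends-in-0 v = go (initLast v)
  where
  go : ∀ {v} → InitLast v → ¬ v ≡ [] → Factor (v ++ l1 ∷ []) → Factor (v ++ l2 ∷ []) →
    ∃[ u ] (u ++ l0 ∷ [] ≡ v)
  go []        v≢[] _  _  = ⊥-elim (v≢[] refl)
  go (u ∷ʳ′ _) _    f₁ f₂ =
    u , cong (λ c → u ++ c ∷ []) (sym (before-1-and-2 (bigram-last u f₁) (bigram-last u f₂)))

Factor-1∷-2∷⇒[] : ∀ {w} → Factor (l1 ∷ w) → Factor (l2 ∷ w) → w ≡ []
Factor-1∷-2∷⇒[] {[]}    _  _  = refl
Factor-1∷-2∷⇒[] {_ ∷ _} f₁ f₂ = ⊥-elim (¬after-1-and-2 (bigram f₁) (bigram f₂))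

Factor-∷ʳ0-∷ʳ1⇒[] : ∀ w → Factor (w ++ l0 ∷ []) → Factor (w ++ l1 ∷ []) → w ≡ []
Factor-∷ʳ0-∷ʳ1⇒[] w = go (initLast w)
  where
  go : ∀ {w} → InitLast w → Factor (w ++ l0 ∷ []) → Factor (w ++ l1 ∷ []) → w ≡ []
  go []        _  _  = refl
  go (u ∷ʳ′ _) f₀ f₁ = ⊥-elim (¬before-0-and-1 (bigram-last u f₀) (bigram-last u f₁))

Factor-0∷⁺ : ∀ {w} → Factor (l2 ∷ w) → Factor (l0 ∷ w) ⊎ Factor (l1 ∷ w) → Factor (l0 ∷ w)
Factor-0∷⁺ _  (inj₁ f₀) = f₀
Factor-0∷⁺ f₂ (inj₂ f₁) with refl ← Factor-1∷-2∷⇒[] f₁ f₂ = occursAt⇒Factor {0} (refl , tt)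

Factor-∷ʳ2⁺ : ∀ w → Factor (w ++ l1 ∷ []) → Factor (w ++ l0 ∷ []) ⊎ Factor (w ++ l2 ∷ []) →
  Factor (w ++ l2 ∷ [])
Factor-∷ʳ2⁺ w f₁ (inj₁ f₀) with refl ← Factor-∷ʳ0-∷ʳ1⇒[] w f₀ f₁ = occursAt⇒Factor {2} (refl , tt)
Factor-∷ʳ2⁺ _ _  (inj₂ f₂) = f₂

-- Desubstitution

desubstitute : ∀ u {c} z → Factor (u ++ c ∷ z) → AtBoundary u → BlockHead c →
  ∃[ t ] ∃[ s ] ∃[ b ] (φ t ≡ u × φ s ≡ c ∷ z ++ b × Factor (t ++ s))
desubstitute u {c} z f hu hc
  with m , a , b , e ← Factor⇒infix-φ² f
  with y₁ , y , e₁ , _ , e₂ ← φ-split (φ (p-prefix m)) a (trans e (cong (a ++_) (++-assoc u (c ∷ z) b)))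
                                (atBoundary-++⁺ u hu hc)
  with t , s , refl , e₃ , e₄ ← φ-split y u e₂ hc =
  t , s , b , e₃ , e₄ , p-prefix-suffix⇒Factor (suc m) y₁ e₁

Factor-φ⁻¹ : ∀ t {c} z → Factor (φ t ++ c ∷ z) → BlockHead c → Factor t
Factor-φ⁻¹ t z f hc =
  let t′ , _ , _ , e , _ , f′ = desubstitute (φ t) z f (φ-atBoundary t) hc
  in subst Factor (φ-injective t′ t e) (Factor-++⁻ˡ t′ f′)

-- The letter following the final 1 is a block head, so the occurrence extends to one ending on a boundary.
Factor-φ⁻¹-1 : ∀ t u → φ t ≡ u ++ l1 ∷ [] → Factor (φ t) → Factor t
Factor-φ⁻¹-1 t u e f =
  let c , g = Factor-extendʳ (φ t) f
  in Factor-φ⁻¹ t [] g (after-1 (bigram-last u (subst (λ w → Factor (w ++ c ∷ [])) e g)))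

φ-extendʳ : ∀ t {c} z → Factor (φ t ++ c ∷ z) → BlockHead c →
  ∃[ x ] ∃[ s ] ∃[ b ] (φ (x ∷ s) ≡ c ∷ z ++ b × Factor (t ++ x ∷ []))
φ-extendʳ t {c} z f hc =
  let t′ , s , b , e , es , f′ = desubstitute (φ t) z f (φ-atBoundary t) hc
  in first-letter s b es (subst (λ t″ → Factor (t″ ++ s)) (φ-injective t′ t e) f′)
  where
  first-letter : ∀ s b → φ s ≡ c ∷ z ++ b → Factor (t ++ s) →
    ∃[ x ] ∃[ s′ ] ∃[ b′ ] (φ (x ∷ s′) ≡ c ∷ z ++ b′ × Factor (t ++ x ∷ []))
  first-letter []      _ () _
  first-letter (x ∷ s) b es f′ =
    x , s , b , es , Factor-++⁻ˡ (t ++ x ∷ []) (subst Factor (sym (++-assoc t (x ∷ []) s)) f′)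

φ-∷≡2∷ : ∀ x s {b} → φ (x ∷ s) ≡ l2 ∷ b → x ≡ l1
φ-∷≡2∷ zero             _ ()
φ-∷≡2∷ (suc zero)       _ _  = refl
φ-∷≡2∷ (suc (suc zero)) _ ()

φ-∷≡0∷ : ∀ x s {b} → φ (x ∷ s) ≡ l0 ∷ b → x ≡ l0 ⊎ x ≡ l2
φ-∷≡0∷ zero             _ _  = inj₁ refl
φ-∷≡0∷ (suc zero)       _ ()
φ-∷≡0∷ (suc (suc zero)) _ _  = inj₂ refl

φ-∷≡0∷2∷ : ∀ x s {b} → φ (x ∷ s) ≡ l0 ∷ l2 ∷ b → x ≡ l2
φ-∷≡0∷2∷ zero             _ ()
φ-∷≡0∷2∷ (suc zero)       _ ()
φ-∷≡0∷2∷ (suc (suc zero)) _ _  = refl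

Factor-φ-∷ʳ2 : ∀ t → Factor (φ t ++ l2 ∷ []) → Factor (t ++ l1 ∷ [])
Factor-φ-∷ʳ2 t f =
  let x , s , _ , e , f′ = φ-extendʳ t [] f head-2
  in subst (λ x → Factor (t ++ x ∷ [])) (φ-∷≡2∷ x s e) f′

Factor-φ-∷ʳ0 : ∀ t → Factor (φ t ++ l0 ∷ []) → Factor (t ++ l0 ∷ []) ⊎ Factor (t ++ l2 ∷ [])
Factor-φ-∷ʳ0 t f =
  let x , s , _ , e , f′ = φ-extendʳ t [] f head-0
      after-t = λ {y} (x≡y : x ≡ y) → subst (λ x → Factor (t ++ x ∷ [])) x≡y f′
  in Sum.map after-t after-t (φ-∷≡0∷ x s e)

Factor-φ-∷ʳ02 : ∀ t → Factor (φ t ++ l0 ∷ l2 ∷ []) → Factor (t ++ l2 ∷ [])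
Factor-φ-∷ʳ02 t f =
  let x , s , _ , e , f′ = φ-extendʳ t (l2 ∷ []) f head-0
  in subst (λ x → Factor (t ++ x ∷ [])) (φ-∷≡0∷2∷ x s e) f′

right-extensions-φ : ∀ t → Factor (φ t ++ l0 ∷ []) → Factor (φ t ++ l2 ∷ []) →
  Factor (t ++ l1 ∷ []) × Factor (t ++ l2 ∷ [])
right-extensions-φ t f₀ f₂ = ft1 , Factor-∷ʳ2⁺ t ft1 (Factor-φ-∷ʳ0 t f₀)
  where
  ft1 : Factor (t ++ l1 ∷ [])
  ft1 = Factor-φ-∷ʳ2 t f₂

right-extensions-φ0 : ∀ t →
  Factor ((φ t ++ l0 ∷ []) ++ l1 ∷ []) → Factor ((φ t ++ l0 ∷ []) ++ l2 ∷ []) →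
  Factor (t ++ l0 ∷ []) × Factor (t ++ l2 ∷ [])
right-extensions-φ0 t f₁ f₂ =
  Factor-φ⁻¹-1 (t ++ l0 ∷ []) (φ t ++ l0 ∷ []) φt0 (subst Factor (sym φt0) f₁) ,
  Factor-φ-∷ʳ02 t (subst Factor (++-assoc (φ t) (l0 ∷ []) (l2 ∷ [])) f₂)
  where
  φt0 : φ (t ++ l0 ∷ []) ≡ (φ t ++ l0 ∷ []) ++ l1 ∷ []
  φt0 = trans (φ-++ t (l0 ∷ [])) (sym (++-assoc (φ t) (l0 ∷ []) (l1 ∷ [])))

φ-preimage : ∀ u {c} z → Factor (l1 ∷ u) → Factor (u ++ c ∷ z) → BlockHead c → ∃[ t ] (φ t ≡ u)
φ-preimage u z f₁ f hc = let t , _ , _ , e , _ = desubstitute u z f (Factor-1∷⇒atBoundary f₁) hc in t , e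

φ-preimage-∷ʳ0 : ∀ u → Factor (l1 ∷ u ++ l0 ∷ []) → Factor ((u ++ l0 ∷ []) ++ l2 ∷ []) →
  ∃[ t ] (φ t ≡ u)
φ-preimage-∷ʳ0 u f₁ f₂ =
  φ-preimage u (l2 ∷ []) (Factor-++⁻ˡ (l1 ∷ u) f₁)
    (subst Factor (++-assoc u (l0 ∷ []) (l2 ∷ [])) f₂) head-0

-- Bispecial factors

shape-1φ : ∀ v → ¬ v ≡ [] → Factor (l2 ∷ v) → Factor (v ++ l2 ∷ []) → ∃[ t ] (l1 ∷ φ t ≡ v)
shape-1φ []      v≢[] _   _   = ⊥-elim (v≢[] refl)
shape-1φ (x ∷ u) _    f2v fv2 =
  let x≡1   = after-2 (bigram f2v)
      t , e = φ-preimage u [] (subst (λ x → Factor (x ∷ u)) x≡1 (Factor-++⁻ʳ (l2 ∷ []) f2v))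
                (Factor-++⁻ʳ (x ∷ []) fv2) head-2
  in t , cong₂ _∷_ (sym x≡1) e

shape-φ0 : ∀ v → ¬ v ≡ [] → Factor (l1 ∷ v) → Factor (v ++ l1 ∷ []) → Factor (v ++ l2 ∷ []) →
  ∃[ t ] (φ t ++ l0 ∷ [] ≡ v)
shape-φ0 v v≢[] f1v fv1 fv2 = go (ends-in-0 v v≢[] fv1 fv2) f1v fv2
  where
  go : ∀ {v} → ∃[ u ] (u ++ l0 ∷ [] ≡ v) → Factor (l1 ∷ v) → Factor (v ++ l2 ∷ []) →
    ∃[ t ] (φ t ++ l0 ∷ [] ≡ v)
  go (u , refl) f1v fv2 = let t , e = φ-preimage-∷ʳ0 u f1v fv2 in t , cong (_++ l0 ∷ []) e

shape-1φ0 : ∀ v → ¬ v ≡ [] → Factor (l2 ∷ v) → Factor (v ++ l1 ∷ []) → Factor (v ++ l2 ∷ []) →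
  ∃[ t ] (l1 ∷ φ t ++ l0 ∷ [] ≡ v)
shape-1φ0 v v≢[] f2v fv1 fv2 = go (ends-in-0 v v≢[] fv1 fv2) f2v fv2
  where
  go : ∀ {v} → ∃[ u ] (u ++ l0 ∷ [] ≡ v) → Factor (l2 ∷ v) → Factor (v ++ l2 ∷ []) →
    ∃[ t ] (l1 ∷ φ t ++ l0 ∷ [] ≡ v)
  go ([]    , refl) f2v _   = contradiction (after-2 (bigram f2v)) λ ()
  go (x ∷ u , refl) f2v fv2 =
    let x≡1   = after-2 (bigram f2v)
        t , e = φ-preimage-∷ʳ0 u (subst (λ x → Factor (x ∷ u ++ l0 ∷ [])) x≡1 (Factor-++⁻ʳ (l2 ∷ []) f2v))
                  (Factor-++⁻ʳ (x ∷ []) fv2)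
    in t , cong₂ _∷_ (sym x≡1) (cong (_++ l0 ∷ []) e)

bispecial-1φ : ∀ {v} → ∃[ t ] (l1 ∷ φ t ≡ v) →
  Factor (l0 ∷ v) → Factor (l2 ∷ v) → Factor (v ++ l0 ∷ []) → Factor (v ++ l2 ∷ []) →
  ∃[ w ] (v ≡ l1 ∷ φ w × Factor (l0 ∷ w) × Factor (l1 ∷ w) × Factor (w ++ l1 ∷ []) × Factor (w ++ l2 ∷ []))
bispecial-1φ (t , refl) f0v f2v fv0 fv2 =
  let u , e = ends-in-1 (l1 ∷ φ t) (λ ()) fv0 in
  t , refl ,
  Factor-φ⁻¹-1 (l0 ∷ t) (l0 ∷ u) (cong (l0 ∷_) e) f0v ,
  Factor-φ⁻¹-1 (l1 ∷ t) (l2 ∷ u) (cong (l2 ∷_) e) f2v ,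
  right-extensions-φ t (Factor-++⁻ʳ (l1 ∷ []) fv0) (Factor-++⁻ʳ (l1 ∷ []) fv2)

bispecial-φ0 : ∀ {v} → ∃[ t ] (φ t ++ l0 ∷ [] ≡ v) →
  Factor (l0 ∷ v) → Factor (l1 ∷ v) → Factor (v ++ l1 ∷ []) → Factor (v ++ l2 ∷ []) →
  ∃[ w ] (v ≡ φ w ++ l0 ∷ [] × Factor (l0 ∷ w) × Factor (l2 ∷ w) × Factor (w ++ l0 ∷ []) × Factor (w ++ l2 ∷ []))
bispecial-φ0 (t , refl) f0v f1v fv1 fv2 =
  let f2t  = Factor-φ⁻¹ (l2 ∷ t) [] f0v head-0
      lift = λ x (g : Factor (φ (x ∷ t) ++ l0 ∷ [])) → Factor-φ⁻¹ (x ∷ t) [] g head-0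
  in t , refl , Factor-0∷⁺ f2t (Sum.map (lift l0) (lift l1) (Factor-extendˡ-1 f1v)) , f2t ,
     right-extensions-φ0 t fv1 fv2

bispecial-1φ0 : ∀ {v} → ∃[ t ] (l1 ∷ φ t ++ l0 ∷ [] ≡ v) →
  Factor (l0 ∷ v) → Factor (l2 ∷ v) → Factor (v ++ l1 ∷ []) → Factor (v ++ l2 ∷ []) →
  ∃[ w ] (v ≡ l1 ∷ φ w ++ l0 ∷ [] × Factor (l0 ∷ w) × Factor (l1 ∷ w) × Factor (w ++ l0 ∷ []) × Factor (w ++ l2 ∷ []))
bispecial-1φ0 (t , refl) f0v f2v fv1 fv2 =
  t , refl , Factor-φ⁻¹ (l0 ∷ t) [] f0v head-0 , Factor-φ⁻¹ (l1 ∷ t) [] f2v head-0 ,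
  right-extensions-φ0 t (Factor-++⁻ʳ (l1 ∷ []) fv1) (Factor-++⁻ʳ (l1 ∷ []) fv2)

bispecial-φ : ∀ {v} → ¬ v ≡ [] → ∃[ t ] (φ t ≡ v) →
  Factor (l0 ∷ v) → Factor (l1 ∷ v) → Factor (v ++ l0 ∷ []) → Factor (v ++ l2 ∷ []) →
  ∃[ w ] (v ≡ φ w × Factor (l0 ∷ w) × Factor (l2 ∷ w) × Factor (w ++ l1 ∷ []) × Factor (w ++ l2 ∷ []))
bispecial-φ v≢[] (t , refl) f0v f1v fv0 fv2 =
  let u , e = ends-in-1 (φ t) v≢[] fv0
      f2t   = Factor-φ⁻¹-1 (l2 ∷ t) (l0 ∷ u) (cong (l0 ∷_) e) f0v
      lift  = λ x → Factor-φ⁻¹-1 (x ∷ t) (φₗ x ++ u)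
                      (trans (cong (φₗ x ++_) e) (sym (++-assoc (φₗ x) u (l1 ∷ []))))
  in t , refl , Factor-0∷⁺ f2t (Sum.map (lift l0) (lift l1) (Factor-extendˡ-1 f1v)) , f2t ,
     right-extensions-φ t fv0 fv2

corollary8 : (v : Word) → ¬ (v ≡ []) → Factor v →
    ((Factor (l0 ∷ v) × Factor (l2 ∷ v) × Factor (v ++ l0 ∷ []) × Factor (v ++ l2 ∷ [])) →
      ∃[ w ] (v ≡ l1 ∷ φ w × Factor (l0 ∷ w) × Factor (l1 ∷ w) × Factor (w ++ l1 ∷ []) × Factor (w ++ l2 ∷ [])))
    × ((Factor (l0 ∷ v) × Factor (l1 ∷ v) × Factor (v ++ l1 ∷ []) × Factor (v ++ l2 ∷ [])) →
      ∃[ w ] (v ≡ φ w ++ l0 ∷ [] × Factor (l0 ∷ w) × Factor (l2 ∷ w) × Factor (w ++ l0 ∷ []) × Factor (w ++ l2 ∷ [])))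
    × ((Factor (l0 ∷ v) × Factor (l2 ∷ v) × Factor (v ++ l1 ∷ []) × Factor (v ++ l2 ∷ [])) →
      ∃[ w ] (v ≡ l1 ∷ φ w ++ l0 ∷ [] × Factor (l0 ∷ w) × Factor (l1 ∷ w) × Factor (w ++ l0 ∷ []) × Factor (w ++ l2 ∷ [])))
    × ((Factor (l0 ∷ v) × Factor (l1 ∷ v) × Factor (v ++ l0 ∷ []) × Factor (v ++ l2 ∷ [])) →
      ∃[ w ] (v ≡ φ w × Factor (l0 ∷ w) × Factor (l2 ∷ w) × Factor (w ++ l1 ∷ []) × Factor (w ++ l2 ∷ [])))
corollary8 v v≢[] _ =
  (λ (f0v , f2v , fv0 , fv2) → bispecial-1φ (shape-1φ v v≢[] f2v fv2) f0v f2v fv0 fv2) ,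
  (λ (f0v , f1v , fv1 , fv2) → bispecial-φ0 (shape-φ0 v v≢[] f1v fv1 fv2) f0v f1v fv1 fv2) ,
  (λ (f0v , f2v , fv1 , fv2) → bispecial-1φ0 (shape-1φ0 v v≢[] f2v fv1 fv2) f0v f2v fv1 fv2) ,
  (λ (f0v , f1v , fv0 , fv2) → bispecial-φ v≢[] (φ-preimage v [] f1v fv2 head-2) f0v f1v fv0 fv2)
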